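{- Let $k\ge 1$ be an integer and let $G$ be a graph. Then $i_{[kR]}(G)=(k+1)\,i(G)$ if and only if $G$ has an $i_{[kR]}$-function $f$ such that no vertex of $G$ has label $k$ under $f$.
   Context: All graphs are finite and simple. $i(G)$ is the minimum size of an independent dominating set of $G$. For $f\colon V(G)\to\mathbb{Z}_{\ge 0}$ and $S\subseteq V(G)$, $f(S)=\sum_{v\in S}f(v)$, and $AN(v)=\{w\in N(v): f(w)\ge 1\}$. A $[k]$-Roman dominating function of $G$ is a function $f\colon V(G)\to\{0,1,\ldots,k+1\}$ such that $f(N[v])\ge k+|AN(v)|$ for every vertex $v$ with $f(v)<k$; its weight is $f(V(G))$. An independent $[k]$-Roman dominating function ($[k]$-IRDF) is one whose set of vertices with positive label is independent (such a function only uses labels in $\{0,k,k+1\}$); $i_{[kR]}(G)$ is the minimum weight of a $[k]$-IRDF, and an $i_{[kR]}$-function is a $[k]$-IRDF of weight $i_{[kR]}(G)$. -}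

module Defs where

open import Data.Nat using (ℕ; zero; suc; _+_; _*_; _≤_; _<_)
open import Data.Bool using (Bool; true; false; if_then_else_; _∧_)
open import Data.Fin using (Fin)
open import Data.List using (List; map)
open import Data.Nat.ListAction using (sum)
open import Data.Sum using (_⊎_; inj₁; inj₂)
open import Data.List.Base using (allFin)
open import Data.Product using (Σ; _×_; ∃)
open import Data.Empty using (⊥)
open import Relation.Nullary using (¬_)
open import Relation.Binary.PropositionalEquality using (_≡_)

record Graph : Set where
  field
    n      : ℕ
    adj    : Fin n → Fin n → Bool
    sym    : ∀ u v → adj u v ≡ adj v u
    irrefl : ∀ v → adj v v ≡ false
open Graph public

ΣV : (G : Graph) → (Fin (n G) → ℕ) → ℕ
ΣV G g = sum (map g (allFin (n G)))

Labeling : Graph → Set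
Labeling G = Fin (n G) → ℕ

weight : (G : Graph) → Labeling G → ℕ
weight G f = ΣV G f

fN[_] : (G : Graph) → Labeling G → Fin (n G) → ℕ
fN[ G ] f v = f v + ΣV G (λ w → if adj G v w then f w else 0)

pos : ℕ → ℕ
pos zero = 0
pos (suc _) = 1

|AN| : (G : Graph) → Labeling G → Fin (n G) → ℕ
|AN| G f v = ΣV G (λ w → if adj G v w then pos (f w) else 0)

IsKRDF : (G : Graph) → ℕ → Labeling G → Set
IsKRDF G k f =
  (∀ v → f v ≤ suc k) ×
  (∀ v → f v < k → k + |AN| G f v ≤ fN[ G ] f v)

PosIndependent : (G : Graph) → Labeling G → Set
PosIndependent G f = ∀ u v → adj G u v ≡ true → 1 ≤ f u → 1 ≤ f v → ⊥

IsKIRDF : (G : Graph) → ℕ → Labeling G → Set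
IsKIRDF G k f = IsKRDF G k f × PosIndependent G f

IsIkRFunction : (G : Graph) → ℕ → Labeling G → Set
IsIkRFunction G k f = IsKIRDF G k f × (∀ g → IsKIRDF G k g → weight G f ≤ weight G g)

IsIkR : (G : Graph) → ℕ → ℕ → Set
IsIkR G k m = (∃ λ f → IsKIRDF G k f × weight G f ≡ m) ×
              (∀ g → IsKIRDF G k g → m ≤ weight G g)

VSet : Graph → Set
VSet G = Fin (n G) → Bool

b2n : Bool → ℕ
b2n true = 1
b2n false = 0

card : (G : Graph) → VSet G → ℕ
card G S = ΣV G (λ v → b2n (S v))

IsIndependent : (G : Graph) → VSet G → Set
IsIndependent G S = ∀ u v → S u ≡ true → S v ≡ true → adj G u v ≡ false

IsDominating : (G : Graph) → VSet G → Set
IsDominating G S = ∀ v → S v ≡ true ⊎ ∃ λ u → S u ≡ true × adj G u v ≡ true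

IsIndDom : (G : Graph) → VSet G → Set
IsIndDom G S = IsIndependent G S × IsDominating G S

IsIndDomNumber : (G : Graph) → ℕ → Set
IsIndDomNumber G m = (∃ λ S → IsIndDom G S × card G S ≡ m) ×
                     (∀ T → IsIndDom G T → m ≤ card G T)

-- If S is an independent dominating set, labelling S with k + 1 and all other vertices
-- with 0 is a [k]-IRDF of weight (k + 1)|S|, so i_[kR](G) ≤ (k + 1) i(G), and this labelling
-- never uses the label k. Conversely, a vertex with positive label under a [k]-IRDF has
-- only unlabelled neighbours, so the Roman condition forces its label to be at least k;
-- the positive vertices form an independent dominating set. If the label k does not occur,
-- every positive label is k + 1, so the weight is at least (k + 1) i(G).
module Submission where

open import Defs hiding (sym)
open import Data.Nat using (ℕ; zero; suc; _+_; _*_; _≤_; _<_; z≤n; s≤s; _<?_)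
open import Data.Nat.Properties
open import Data.Bool using (Bool; true; false; if_then_else_)
open import Data.Fin using (Fin)
open import Data.List using (List; []; _∷_; map; allFin)
open import Data.Nat.ListAction using (sum)
open import Data.List.Membership.Propositional using (_∈_)
open import Data.List.Membership.Propositional.Properties using (∈-allFin)
open import Data.List.Relation.Unary.Any using (here; there)
open import Data.Sum using (inj₁; inj₂)
open import Data.Product using (_×_; ∃; _,_; proj₂)
open import Data.Empty using (⊥-elim)
open import Relation.Nullary using (¬_; yes; no; contradiction)
open import Relation.Binary.PropositionalEquality
open import Function.Bundles using (_⇔_; mk⇔)

module _ {A : Set} where

  sum-map-cong : {g h : A → ℕ} → (∀ x → g x ≡ h x) → ∀ l → sum (map g l) ≡ sum (map h l)
  sum-map-cong g≡h []      = refl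
  sum-map-cong g≡h (x ∷ l) = cong₂ _+_ (g≡h x) (sum-map-cong g≡h l)

  sum-map-mono : {g h : A → ℕ} → (∀ x → g x ≤ h x) → ∀ l → sum (map g l) ≤ sum (map h l)
  sum-map-mono g≤h []      = z≤n
  sum-map-mono g≤h (x ∷ l) = +-mono-≤ (g≤h x) (sum-map-mono g≤h l)

  sum-map-* : ∀ c (g : A → ℕ) l → sum (map (λ x → c * g x) l) ≡ c * sum (map g l)
  sum-map-* c g []      = sym (*-zeroʳ c)
  sum-map-* c g (x ∷ l) = begin
    c * g x + sum (map (λ x → c * g x) l) ≡⟨ cong (c * g x +_) (sum-map-* c g l) ⟩
    c * g x + c * sum (map g l)           ≡⟨ *-distribˡ-+ c (g x) _ ⟨
    c * (g x + sum (map g l))             ∎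
    where open ≡-Reasoning

  sum-map-≡0 : {g : A → ℕ} → (∀ x → g x ≡ 0) → ∀ l → sum (map g l) ≡ 0
  sum-map-≡0 g≡0 []      = refl
  sum-map-≡0 g≡0 (x ∷ l) = cong₂ _+_ (g≡0 x) (sum-map-≡0 g≡0 l)

  ∈⇒≤sum-map : (g : A → ℕ) {x : A} {l : List A} → x ∈ l → g x ≤ sum (map g l)
  ∈⇒≤sum-map g {l = y ∷ l} (here refl) = m≤m+n (g y) _
  ∈⇒≤sum-map g {l = y ∷ l} (there x∈l) = ≤-trans (∈⇒≤sum-map g x∈l) (m≤n+m _ (g y))

  sum-map-positive : (g : A → ℕ) (l : List A) → 0 < sum (map g l) → ∃ λ x → 0 < g x
  sum-map-positive g (x ∷ l) 0<sum with g x in gx≡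
  ... | suc _ = x , subst (0 <_) (sym gx≡) (s≤s z≤n)
  ... | zero  = sum-map-positive g l 0<sum

-- fN[ G ] f v and |AN| G f v are definitionally f v + ΣN G f v and ΣN G (pos ∘ f) v.
ΣN : (G : Graph) → Labeling G → Fin (n G) → ℕ
ΣN G h v = ΣV G (λ w → if adj G v w then h w else 0)

module _ (G : Graph) where

  ΣN-cong : {h h′ : Labeling G} → (∀ w → h w ≡ h′ w) → ∀ v → ΣN G h v ≡ ΣN G h′ v
  ΣN-cong h≡h′ v = sum-map-cong term (allFin (n G))
    where
    term : ∀ w → (if adj G v w then _ else 0) ≡ (if adj G v w then _ else 0)
    term w with adj G v w
    ... | true  = h≡h′ w
    ... | false = refl

  ΣN-* : ∀ c (h : Labeling G) v → ΣN G (λ w → c * h w) v ≡ c * ΣN G h v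
  ΣN-* c h v = trans (sum-map-cong term (allFin (n G))) (sum-map-* c _ (allFin (n G)))
    where
    term : ∀ w → (if adj G v w then c * h w else 0) ≡ c * (if adj G v w then h w else 0)
    term w with adj G v w
    ... | true  = refl
    ... | false = sym (*-zeroʳ c)

  ΣN-≡0 : {h : Labeling G} {v : Fin (n G)} → (∀ w → adj G v w ≡ true → h w ≡ 0) → ΣN G h v ≡ 0
  ΣN-≡0 {h} {v} nbr≡0 = sum-map-≡0 term (allFin (n G))
    where
    term : ∀ w → (if adj G v w then h w else 0) ≡ 0
    term w with adj G v w in vw
    ... | true  = nbr≡0 w vw
    ... | false = refl

  adj⇒≤ΣN : (h : Labeling G) {v w : Fin (n G)} → adj G v w ≡ true → h w ≤ ΣN G h v
  adj⇒≤ΣN h {v} {w} vw = subst (_≤ ΣN G h v) term (∈⇒≤sum-map _ (∈-allFin w))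
    where
    term : (if adj G v w then h w else 0) ≡ h w
    term rewrite vw = refl

  ΣN-positive : (h : Labeling G) {v : Fin (n G)} → 0 < ΣN G h v →
                ∃ λ w → adj G v w ≡ true × 0 < h w
  ΣN-positive h {v} 0<ΣN = neighbour (sum-map-positive _ (allFin (n G)) 0<ΣN)
    where
    neighbour : (∃ λ w → 0 < (if adj G v w then h w else 0)) → ∃ λ w → adj G v w ≡ true × 0 < h w
    neighbour (w , 0<term) with adj G v w in vw
    ... | true = w , vw , 0<term

  IsKIRDF-positive⇒≥k : ∀ {k f} → IsKIRDF G k f → ∀ v → 1 ≤ f v → k ≤ f v
  IsKIRDF-positive⇒≥k {k} {f} ((_ , roman) , indep) v 0<fv with f v <? k
  ... | no fv≮k  = ≮⇒≥ fv≮k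
  ... | yes fv<k = contradiction fv<k (≤⇒≯ k≤fv)
    where
    open ≤-Reasoning
    k≤fv : k ≤ f v
    k≤fv = begin
      k                  ≤⟨ m≤m+n k _ ⟩
      k + |AN| G f v     ≤⟨ roman v fv<k ⟩
      f v + ΣN G f v     ≡⟨ cong (f v +_) (ΣN-≡0 λ w vw → n≤0⇒n≡0 (≮⇒≥ (indep v w vw 0<fv))) ⟩
      f v + 0            ≡⟨ +-identityʳ (f v) ⟩
      f v                ∎

  unlabelled⇒positive-neighbour : ∀ {k f} → 1 ≤ k → IsKRDF G k f → ∀ {v} → f v ≡ 0 →
                                  ∃ λ w → adj G v w ≡ true × 0 < f w
  unlabelled⇒positive-neighbour {k} {f} 0<k (_ , roman) {v} fv≡0 = ΣN-positive f (begin-strict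
    0                  <⟨ 0<k ⟩
    k                  ≤⟨ m≤m+n k _ ⟩
    k + |AN| G f v     ≤⟨ roman v (subst (_< k) (sym fv≡0) 0<k) ⟩
    f v + ΣN G f v     ≡⟨ cong (_+ ΣN G f v) fv≡0 ⟩
    ΣN G f v           ∎)
    where open ≤-Reasoning

nonzero : ℕ → Bool
nonzero zero    = false
nonzero (suc _) = true

nonzero⇒positive : ∀ {m} → nonzero m ≡ true → 0 < m
nonzero⇒positive {suc _} _ = s≤s z≤n

positive⇒nonzero : ∀ {m} → 0 < m → nonzero m ≡ true
positive⇒nonzero {suc _} _ = refl

support : (G : Graph) → Labeling G → VSet G
support G f v = nonzero (f v)

support-IsIndDom : ∀ G {k f} → 1 ≤ k → IsKIRDF G k f → IsIndDom G (support G f)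
support-IsIndDom G {k} {f} 0<k (krdf , indep) = independent , dominating
  where
  independent : IsIndependent G (support G f)
  independent u v u∈ v∈ with adj G u v in uv
  ... | true  = ⊥-elim (indep u v uv (nonzero⇒positive u∈) (nonzero⇒positive v∈))
  ... | false = refl
  dominating : IsDominating G (support G f)
  dominating v with f v in fv≡
  ... | suc _ = inj₁ refl
  ... | zero with unlabelled⇒positive-neighbour G 0<k krdf fv≡
  ...   | w , vw , 0<fw = inj₂ (w , positive⇒nonzero 0<fw , trans (Graph.sym G w v) vw)

labelOn : (G : Graph) → ℕ → VSet G → Labeling G
labelOn G c S v = if S v then c else 0

*-b2n : ∀ c b → c * b2n b ≡ (if b then c else 0)
*-b2n c true  = *-identityʳ c
*-b2n c false = *-zeroʳ c

weight-labelOn : ∀ G c S → weight G (labelOn G c S) ≡ c * card G S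
weight-labelOn G c S =
  trans (sum-map-cong (λ v → sym (*-b2n c (S v))) (allFin (n G))) (sum-map-* c _ (allFin (n G)))

labelOn-support-≤ : ∀ G {c f} → (∀ v → 1 ≤ f v → c ≤ f v) → ∀ v → labelOn G c (support G f) v ≤ f v
labelOn-support-≤ G {f = f} c≤positive v with f v | c≤positive v
... | zero  | _      = z≤n
... | suc _ | c≤fv   = c≤fv (s≤s z≤n)

*-card-support≤weight : ∀ G {c f} → (∀ v → 1 ≤ f v → c ≤ f v) → c * card G (support G f) ≤ weight G f
*-card-support≤weight G {c} {f} c≤positive =
  subst (_≤ weight G f) (weight-labelOn G c (support G f))
        (sum-map-mono (labelOn-support-≤ G c≤positive) (allFin (n G)))

module _ (G : Graph) {k : ℕ} {S : VSet G} where

  labelOn-≢k : 1 ≤ k → ∀ v → ¬ (labelOn G (suc k) S v ≡ k)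
  labelOn-≢k 0<k v with S v
  ... | true  = 1+n≢n
  ... | false = λ 0≡k → m<n⇒n≢0 0<k (sym 0≡k)

  labelOn-IsKIRDF : 1 ≤ k → IsIndDom G S → IsKIRDF G k (labelOn G (suc k) S)
  labelOn-IsKIRDF 0<k (indS , domS) = (bounded , roman) , independent
    where
    g : Labeling G
    g = labelOn G (suc k) S
    χ : Labeling G
    χ v = b2n (S v)

    bounded : ∀ v → g v ≤ suc k
    bounded v with S v
    ... | true  = ≤-refl
    ... | false = z≤n

    <k⇒∉ : ∀ {v} → g v < k → S v ≡ false
    <k⇒∉ {v} gv<k with S v
    ... | true  = contradiction gv<k (≤⇒≯ (n≤1+n k))
    ... | false = refl

    pos-g : ∀ w → pos (g w) ≡ χ w
    pos-g w with S w
    ... | true  = refl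
    ... | false = refl

    ΣN-g : ∀ v → ΣN G g v ≡ suc k * ΣN G χ v
    ΣN-g v = trans (ΣN-cong G (λ w → sym (*-b2n (suc k) (S w))) v) (ΣN-* G (suc k) χ v)

    1≤ΣNχ : ∀ {v} → S v ≡ false → 1 ≤ ΣN G χ v
    1≤ΣNχ {v} v∉S with domS v
    ... | inj₁ v∈S = contradiction (trans (sym v∈S) v∉S) λ ()
    ... | inj₂ (u , u∈S , uv) =
      subst (_≤ ΣN G χ v) (cong b2n u∈S) (adj⇒≤ΣN G χ (trans (Graph.sym G v u) uv))

    roman : ∀ v → g v < k → k + |AN| G g v ≤ fN[ G ] g v
    roman v gv<k = begin
      k + |AN| G g v           ≡⟨ cong (k +_) (ΣN-cong G pos-g v) ⟩
      k + A                    ≤⟨ +-monoˡ-≤ A (subst (_≤ k * A) (*-identityʳ k) (*-monoʳ-≤ k (1≤ΣNχ v∉S))) ⟩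
      k * A + A                ≡⟨ +-comm (k * A) A ⟩
      suc k * A                ≡⟨ ΣN-g v ⟨
      ΣN G g v                 ≡⟨ cong (λ b → (if b then suc k else 0) + ΣN G g v) v∉S ⟨
      g v + ΣN G g v           ∎
      where
      open ≤-Reasoning
      A : ℕ
      A = ΣN G χ v
      v∉S : S v ≡ false
      v∉S = <k⇒∉ gv<k

    independent : PosIndependent G g
    independent u v uv 0<gu 0<gv with S u in u∈ | S v in v∈
    ... | true | true = contradiction (trans (sym uv) (indS u v u∈ v∈)) λ ()

IsIkR⇒weight≡ : ∀ G k f {a} → IsIkR G k a → IsIkRFunction G k f → weight G f ≡ a
IsIkR⇒weight≡ G k f ((f₀ , f₀-IRDF , weight-f₀≡a) , a≤) (f-IRDF , f-minimal) =
  ≤-antisym (subst (weight G f ≤_) weight-f₀≡a (f-minimal f₀ f₀-IRDF)) (a≤ f f-IRDF)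

weight≡⇒IsIkRFunction : ∀ G k f {a} → IsIkR G k a → IsKIRDF G k f → weight G f ≡ a → IsIkRFunction G k f
weight≡⇒IsIkRFunction G k f ikr f-IRDF weight-f≡a =
  f-IRDF , λ g g-IRDF → subst (_≤ weight G g) (sym weight-f≡a) (proj₂ ikr g g-IRDF)

lemma3p2 : (k : ℕ) → 1 ≤ k → (G : Graph) → (a b : ℕ) →
    IsIkR G k a → IsIndDomNumber G b →
    (a ≡ suc k * b ⇔ (∃ λ f → IsIkRFunction G k f × (∀ v → ¬ (f v ≡ k))))
lemma3p2 k 0<k G a b ikr ((S , S-IndDom , card-S≡b) , b≤) = mk⇔ to from
  where
  g : Labeling G
  g = labelOn G (suc k) S
  g-IRDF : IsKIRDF G k g
  g-IRDF = labelOn-IsKIRDF G 0<k S-IndDom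
  weight-g≡ : weight G g ≡ suc k * b
  weight-g≡ = trans (weight-labelOn G (suc k) S) (cong (suc k *_) card-S≡b)

  to : a ≡ suc k * b → ∃ λ f → IsIkRFunction G k f × (∀ v → ¬ (f v ≡ k))
  to a≡ = g , weight≡⇒IsIkRFunction G k g ikr g-IRDF (trans weight-g≡ (sym a≡)) , labelOn-≢k G {S = S} 0<k

  from : (∃ λ f → IsIkRFunction G k f × (∀ v → ¬ (f v ≡ k))) → a ≡ suc k * b
  from (f , f-ikr@(f-IRDF , _) , f≢k) = ≤-antisym (subst (a ≤_) weight-g≡ (proj₂ ikr g g-IRDF)) (begin
    suc k * b                        ≤⟨ *-monoʳ-≤ (suc k) (b≤ _ (support-IsIndDom G 0<k f-IRDF)) ⟩
    suc k * card G (support G f)     ≤⟨ *-card-support≤weight G {f = f} positive⇒>k ⟩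
    weight G f                       ≡⟨ IsIkR⇒weight≡ G k f ikr f-ikr ⟩
    a                                ∎)
    where
    open ≤-Reasoning
    positive⇒>k : ∀ v → 1 ≤ f v → suc k ≤ f v
    positive⇒>k v 0<fv = ≤∧≢⇒< (IsKIRDF-positive⇒≥k G f-IRDF v 0<fv) (λ k≡fv → f≢k v (sym k≡fv))
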